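{- For $m\ge1$ and $-1\le i\le m-1$ let $f_i(m)$ denote the number of $i$-dimensional faces of $\mathrm{Ind}(G_m)$, and set $f_m(m)=0$. Then $f_0(m)=3m-1$ for every $m\ge1$; $f_1(m)=(9m^2-19m+12)/2$ for every $m\ge2$; and for $m\ge3$ and $2\le i\le m-1$, $$f_i(m)=2f_{i-1}(m-1)+f_i(m-1)+f_{i-2}(m-2)+f_{i-1}(m-2).$$
   Context: $\mathrm{Ind}(G)$ is the independence complex of $G$; its $i$-dimensional faces are the independent sets of size $i+1$. The graphs $G_m$: $G_1$ has vertices $a_1,b_1$ and edge $a_1b_1$; for $m\ge1$, $G_{m+1}$ is obtained from $G_m$ by adding vertices $a_{m+1},b_{m+1},c_{m+1}$ and edges $a_ma_{m+1}$, $b_mc_{m+1}$, $a_{m+1}b_{m+1}$, $b_{m+1}c_{m+1}$, and, when $m\ge2$, also $c_ma_{m+1}$. -}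

module Defs where

open import Data.Nat using (ℕ; zero; suc; _≡ᵇ_; _+_)
open import Data.Bool using (Bool; true; false; _∧_; _∨_; not; if_then_else_)
open import Data.List using (List; []; _∷_; _++_; map; length; filter)
open import Data.Bool.ListAction using (any; all)
open import Data.Product using (_×_; _,_)
open import Relation.Nullary.Decidable using (does)
open import Relation.Binary.PropositionalEquality using (_≡_)
open import Data.Bool.Properties using (T?)

data V : Set where
  a b c : ℕ → V

_==_ : V → V → Bool
a i == a j = i ≡ᵇ j
b i == b j = i ≡ᵇ j
c i == c j = i ≡ᵇ j
_ == _ = false

-- A finite simple graph given by a duplicate-free vertex list and an edge list.
record Graph : Set where
  field
    verts : List V
    edges : List (V × V)
open Graph public

adjacent : Graph → V → V → Bool
adjacent G u v = any (λ { (x , y) → ((x == u) ∧ (y == v)) ∨ ((x == v) ∧ (y == u)) }) (edges G)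

subsets : List V → List (List V)
subsets []       = [] ∷ []
subsets (x ∷ xs) = subsets xs ++ map (x ∷_) (subsets xs)

independent : Graph → List V → Bool
independent G []       = true
independent G (x ∷ xs) = all (λ y → not (adjacent G x y)) xs ∧ independent G xs

numIndep : Graph → ℕ → ℕ
numIndep G k = length (filter (λ S → T? ((length S ≡ᵇ k) ∧ independent G S)) (subsets (verts G)))

extra : ℕ → List (V × V)
extra (suc (suc k)) = (c (suc (suc k)) , a (suc (suc (suc k)))) ∷ []
extra _             = []

step : ℕ → Graph → Graph
step m G = record
  { verts = verts G ++ (a (suc m) ∷ b (suc m) ∷ c (suc m) ∷ [])
  ; edges = edges G ++ ((a m , a (suc m)) ∷ (b m , c (suc m)) ∷ (a (suc m) , b (suc m))
                        ∷ (b (suc m) , c (suc m)) ∷ extra m)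
  }

-- Gm' n is the graph G_{n+1}.
Gm' : ℕ → Graph
Gm' zero    = record { verts = a 1 ∷ b 1 ∷ [] ; edges = (a 1 , b 1) ∷ [] }
Gm' (suc n) = step (suc n) (Gm' n)

-- G m for m ≥ 1 (G 0 is an unused dummy, the empty graph).
G : ℕ → Graph
G zero    = record { verts = [] ; edges = [] }
G (suc n) = Gm' n

-- f m i = f_i(m) = number of i-dimensional faces of Ind(G_m), i.e. independent
-- sets of size i+1 (for i ≥ 0), with the convention f_m(m) = 0.
f : ℕ → ℕ → ℕ
f m i = if m ≡ᵇ i then 0 else numIndep (G m) (suc i)

{-# OPTIONS --safe #-}
module Submission where

-- Split the vertices of G m into layers L j = {a j, b j, c j} (and L 1 = {a 1, b 1}). Edges only join
-- equal or consecutive layers, so an independent set of G m is an independent set S of G (m - 2)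
-- together with independent sets U ⊆ L (m - 1) and W ⊆ L m, where W only has to avoid the
-- neighbours of U. The independent subsets of L m are ∅, a, b, c and ac; b m has no neighbour in
-- L (m - 1), a m is adjacent to a (m - 1) and c (m - 1), and c m to b (m - 1). So a nonempty
-- independent U rules out exactly one of a m, c m and the empty U rules out neither: counted by
-- size, the sets W extending U contribute 1 + 2x, plus x + x² when U = ∅. This is the recurrence
-- I(G m) = (1 + 2x) I(G (m - 1)) + (x + x²) I(G (m - 2)) of independence polynomials, which is the
-- stated recurrence for f. The formulas for f 0 and f 1 follow by induction, and the convention
-- f m m = 0 agrees with the count since, by the same recurrence, G m has no independent set of
-- more than m vertices.

open import Defs
open import Data.Bool using (Bool; true; false; _∧_; _∨_; not; T)
open import Data.Bool.ListAction using (all; any)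
open import Data.Bool.Properties using (T?; ∧-assoc; ∧-comm; ∧-identityʳ; ∧-zeroʳ; ∨-comm; ∨-assoc; ∨-identityʳ; ¬-not; ∧-commutativeMonoid)
open import Data.List using (List; []; _∷_; _++_; length; map; filter)
open import Data.Nat.ListAction using (sum)
open import Data.Nat.ListAction.Properties using (sum-++)
open import Data.List.Properties using (length-++; ++-identityʳ; map-++; map-∘)
open import Data.List.Relation.Unary.All as All using (All; []; _∷_)
open import Data.List.Relation.Unary.All.Properties using (++⁺)
open import Data.List.Relation.Binary.Sublist.Propositional using (_⊆_; []; _∷_; _∷ʳ_)
open import Data.List.Relation.Binary.Sublist.Propositional.Properties using (All-resp-⊆)
open import Data.Nat using (ℕ; zero; suc; _+_; _*_; _∸_; _≤_; _<_; _≡ᵇ_; z≤n; s≤s)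
open import Data.Nat.Properties using (≡ᵇ⇒≡; ≤-refl; ≤-reflexive; ≤-trans; ≤-<-trans; n≤1+n; m≤n⇒m≤1+n; <⇒≢; >⇒≢; <⇒≤; m≤n⇒m<n∨m≡n; *-suc; 1+n≢n; +-identityʳ; +-comm; +-assoc; *-comm; *-assoc; *-distribˡ-+; +-commutativeSemigroup)
open import Data.Nat.Tactic.RingSolver using (solve-∀)
open import Data.Product using (_×_; _,_; proj₁; proj₂)
open import Function using (_∘_)
open import Data.Empty using (⊥-elim)
open import Data.Sum using (inj₁; inj₂)
open import Relation.Binary.PropositionalEquality using (_≡_; _≢_; refl; sym; trans; cong; cong₂; subst; module ≡-Reasoning)
open import Algebra.Bundles using (CommutativeMonoid)
import Algebra.Properties.CommutativeSemigroup as CommSemigroupProperties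

open CommSemigroupProperties +-commutativeSemigroup using () renaming (interchange to +-interchange)
open CommSemigroupProperties (CommutativeMonoid.commutativeSemigroup ∧-commutativeMonoid) using () renaming (interchange to ∧-interchange)
open ≡-Reasoning

⟦_⟧ : Bool → ℕ
⟦ true  ⟧ = 1
⟦ false ⟧ = 0

⟦∧⟧ : ∀ p q → ⟦ p ∧ q ⟧ ≡ ⟦ p ⟧ * ⟦ q ⟧
⟦∧⟧ true  q = sym (+-identityʳ ⟦ q ⟧)
⟦∧⟧ false q = refl

⟦⟧*-cong : ∀ p {x y} → (p ≡ true → x ≡ y) → ⟦ p ⟧ * x ≡ ⟦ p ⟧ * y
⟦⟧*-cong true  x≡y = cong (1 *_) (x≡y refl)
⟦⟧*-cong false _   = refl

∧-trueʳ : ∀ p {q} → p ∧ q ≡ true → q ≡ true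
∧-trueʳ true  q≡true = q≡true

module _ {A : Set} where

  all-++ : ∀ (p : A → Bool) xs ys → all p (xs ++ ys) ≡ all p xs ∧ all p ys
  all-++ p []       ys = refl
  all-++ p (x ∷ xs) ys = trans (cong (p x ∧_) (all-++ p xs ys)) (sym (∧-assoc (p x) _ _))

  all-∧ : ∀ (p q : A → Bool) xs → all (λ x → p x ∧ q x) xs ≡ all p xs ∧ all q xs
  all-∧ p q []       = refl
  all-∧ p q (x ∷ xs) = trans (cong ((p x ∧ q x) ∧_) (all-∧ p q xs)) (∧-interchange (p x) (q x) _ _)

  all-cong : ∀ {p q : A → Bool} {xs} → All (λ x → p x ≡ q x) xs → all p xs ≡ all q xs
  all-cong []         = refl
  all-cong (px ∷ pxs) = cong₂ _∧_ px (all-cong pxs)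

  all-true : ∀ {p : A → Bool} {xs} → All (λ x → p x ≡ true) xs → all p xs ≡ true
  all-true []         = refl
  all-true (px ∷ pxs) rewrite px = all-true pxs

  any-++ : ∀ (p : A → Bool) xs ys → any p (xs ++ ys) ≡ any p xs ∨ any p ys
  any-++ p []       ys = refl
  any-++ p (x ∷ xs) ys = trans (cong (p x ∨_) (any-++ p xs ys)) (sym (∨-assoc (p x) _ _))

  any-false : ∀ (p : A → Bool) {xs} → All (λ x → p x ≡ false) xs → any p xs ≡ false
  any-false p []         = refl
  any-false p (px ∷ pxs) rewrite px = any-false p pxs

-- Sums over sublists

module _ {A : Set} where

  ΣSub : List A → (List A → ℕ) → ℕ
  ΣSub []       w = w []
  ΣSub (x ∷ xs) w = ΣSub xs w + ΣSub xs (w ∘ (x ∷_))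

  syntax ΣSub xs (λ S → w) = Σ[ S ⊆ xs ] w

  ΣSub-cong : ∀ xs {v w : List A → ℕ} → (∀ {S} → S ⊆ xs → v S ≡ w S) → ΣSub xs v ≡ ΣSub xs w
  ΣSub-cong []       v≡w = v≡w []
  ΣSub-cong (x ∷ xs) v≡w = cong₂ _+_ (ΣSub-cong xs (v≡w ∘ (x ∷ʳ_))) (ΣSub-cong xs (v≡w ∘ (refl ∷_)))

  ΣSub-++ : ∀ xs ys w → ΣSub (xs ++ ys) w ≡ Σ[ S ⊆ xs ] Σ[ T ⊆ ys ] w (S ++ T)
  ΣSub-++ []       ys w = refl
  ΣSub-++ (x ∷ xs) ys w = cong₂ _+_ (ΣSub-++ xs ys w) (ΣSub-++ xs ys (w ∘ (x ∷_)))

  ΣSub-0 : ∀ xs → Σ[ S ⊆ xs ] 0 ≡ 0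
  ΣSub-0 []       = refl
  ΣSub-0 (x ∷ xs) = cong₂ _+_ (ΣSub-0 xs) (ΣSub-0 xs)

  ΣSub-+ : ∀ xs v w → Σ[ S ⊆ xs ] (v S + w S) ≡ ΣSub xs v + ΣSub xs w
  ΣSub-+ []       v w = refl
  ΣSub-+ (x ∷ xs) v w = begin
    Σ[ S ⊆ xs ] (v S + w S) + Σ[ S ⊆ xs ] (v (x ∷ S) + w (x ∷ S))
      ≡⟨ cong₂ _+_ (ΣSub-+ xs v w) (ΣSub-+ xs (v ∘ (x ∷_)) (w ∘ (x ∷_))) ⟩
    (ΣSub xs v + ΣSub xs w) + (ΣSub xs (v ∘ (x ∷_)) + ΣSub xs (w ∘ (x ∷_)))
      ≡⟨ +-interchange (ΣSub xs v) (ΣSub xs w) (ΣSub xs (v ∘ (x ∷_))) (ΣSub xs (w ∘ (x ∷_))) ⟩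
    ΣSub (x ∷ xs) v + ΣSub (x ∷ xs) w ∎

  ΣSub-*ˡ : ∀ xs n w → Σ[ S ⊆ xs ] (n * w S) ≡ n * ΣSub xs w
  ΣSub-*ˡ []       n w = refl
  ΣSub-*ˡ (x ∷ xs) n w = trans (cong₂ _+_ (ΣSub-*ˡ xs n w) (ΣSub-*ˡ xs n (w ∘ (x ∷_)))) (sym (*-distribˡ-+ n _ _))

  ΣSub-empty : ∀ xs (w : List A → ℕ) → Σ[ S ⊆ xs ] (⟦ length S ≡ᵇ 0 ⟧ * w S) ≡ w []
  ΣSub-empty []       w = +-identityʳ (w [])
  ΣSub-empty (x ∷ xs) w = trans (cong₂ _+_ (ΣSub-empty xs w) (ΣSub-0 xs)) (+-identityʳ (w []))

  ΣSub-linear : ∀ xs u v w → Σ[ S ⊆ xs ] (u S + 2 * v S + w S) ≡ ΣSub xs u + 2 * ΣSub xs v + ΣSub xs w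
  ΣSub-linear xs u v w = begin
    Σ[ S ⊆ xs ] (u S + 2 * v S + w S)         ≡⟨ ΣSub-+ xs _ w ⟩
    Σ[ S ⊆ xs ] (u S + 2 * v S) + ΣSub xs w   ≡⟨ cong (_+ ΣSub xs w) (ΣSub-+ xs u _) ⟩
    ΣSub xs u + Σ[ S ⊆ xs ] (2 * v S) + ΣSub xs w
      ≡⟨ cong (λ t → ΣSub xs u + t + ΣSub xs w) (ΣSub-*ˡ xs 2 v) ⟩
    ΣSub xs u + 2 * ΣSub xs v + ΣSub xs w     ∎

-- Independent sets

freeFrom : Graph → List V → V → Bool
freeFrom H S y = all (λ x → not (adjacent H x y)) S

noEdges : Graph → List V → List V → Bool
noEdges H S T = all (freeFrom H S) T

numIndepIn : Graph → List V → ℕ → ℕ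
numIndepIn H xs k = Σ[ S ⊆ xs ] (⟦ length S ≡ᵇ k ⟧ * ⟦ independent H S ⟧)

length-filter-T? : ∀ {B : Set} (p : B → Bool) ys → length (filter (T? ∘ p) ys) ≡ sum (map (⟦_⟧ ∘ p) ys)
length-filter-T? p []       = refl
length-filter-T? p (y ∷ ys) with p y
... | true  = cong suc (length-filter-T? p ys)
... | false = length-filter-T? p ys

sum-map-subsets : ∀ w xs → sum (map w (subsets xs)) ≡ ΣSub xs w
sum-map-subsets w []       = +-identityʳ (w [])
sum-map-subsets w (x ∷ xs) = begin
  sum (map w (subsets xs ++ map (x ∷_) (subsets xs)))
    ≡⟨ cong sum (map-++ w (subsets xs) _) ⟩
  sum (map w (subsets xs) ++ map w (map (x ∷_) (subsets xs)))
    ≡⟨ sum-++ (map w (subsets xs)) _ ⟩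
  sum (map w (subsets xs)) + sum (map w (map (x ∷_) (subsets xs)))
    ≡⟨ cong₂ _+_ (sum-map-subsets w xs) (trans (cong sum (sym (map-∘ (subsets xs)))) (sum-map-subsets (w ∘ (x ∷_)) xs)) ⟩
  ΣSub xs w + ΣSub xs (w ∘ (x ∷_)) ∎

numIndep≡numIndepIn : ∀ H k → numIndep H k ≡ numIndepIn H (verts H) k
numIndep≡numIndepIn H k = begin
  numIndep H k
    ≡⟨ length-filter-T? _ (subsets (verts H)) ⟩
  sum (map (λ S → ⟦ (length S ≡ᵇ k) ∧ independent H S ⟧) (subsets (verts H)))
    ≡⟨ sum-map-subsets _ (verts H) ⟩
  Σ[ S ⊆ verts H ] ⟦ (length S ≡ᵇ k) ∧ independent H S ⟧
    ≡⟨ ΣSub-cong (verts H) (λ {S} _ → ⟦∧⟧ (length S ≡ᵇ k) _) ⟩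
  numIndepIn H (verts H) k ∎

numIndepIn-0 : ∀ H xs → numIndepIn H xs 0 ≡ 1
numIndepIn-0 H xs = ΣSub-empty xs (⟦_⟧ ∘ independent H)

numIndepIn-1 : ∀ H xs → numIndepIn H xs 1 ≡ length xs
numIndepIn-1 H []       = refl
numIndepIn-1 H (x ∷ xs) = begin
  numIndepIn H xs 1 + Σ[ S ⊆ xs ] (⟦ length S ≡ᵇ 0 ⟧ * ⟦ independent H (x ∷ S) ⟧)
    ≡⟨ cong₂ _+_ (numIndepIn-1 H xs) (ΣSub-empty xs (⟦_⟧ ∘ independent H ∘ (x ∷_))) ⟩
  length xs + 1
    ≡⟨ +-comm (length xs) 1 ⟩
  suc (length xs) ∎

numIndep-0 : ∀ H → numIndep H 0 ≡ 1
numIndep-0 H = trans (numIndep≡numIndepIn H 0) (numIndepIn-0 H (verts H))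

module _ (H : Graph) where

  freeFrom-true : ∀ {S y} → All (λ x → adjacent H x y ≡ false) S → freeFrom H S y ≡ true
  freeFrom-true = all-true ∘ All.map (cong not)

  noEdges-true : ∀ {S T} → All (λ y → All (λ x → adjacent H x y ≡ false) S) T → noEdges H S T ≡ true
  noEdges-true = all-true ∘ All.map freeFrom-true

  noEdges-++ˡ : ∀ S U T → noEdges H (S ++ U) T ≡ noEdges H S T ∧ noEdges H U T
  noEdges-++ˡ S U T = trans (all-cong (All.universal (λ y → all-++ _ S U) T)) (all-∧ (freeFrom H S) (freeFrom H U) T)

  independent-++ : ∀ S T → independent H (S ++ T) ≡ (independent H S ∧ noEdges H S T) ∧ independent H T
  independent-++ []      T = cong (_∧ independent H T) (sym (noEdges-true (All.universal (λ _ → []) T)))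
  independent-++ (x ∷ S) T = begin
    all off-x (S ++ T) ∧ independent H (S ++ T)
      ≡⟨ cong₂ _∧_ (all-++ off-x S T) (independent-++ S T) ⟩
    (all off-x S ∧ all off-x T) ∧ ((independent H S ∧ noEdges H S T) ∧ independent H T)
      ≡⟨ sym (∧-assoc (all off-x S ∧ all off-x T) _ _) ⟩
    ((all off-x S ∧ all off-x T) ∧ (independent H S ∧ noEdges H S T)) ∧ independent H T
      ≡⟨ cong (_∧ independent H T) (∧-interchange (all off-x S) _ _ _) ⟩
    ((all off-x S ∧ independent H S) ∧ (all off-x T ∧ noEdges H S T)) ∧ independent H T
      ≡⟨ cong (λ t → ((all off-x S ∧ independent H S) ∧ t) ∧ independent H T) (sym (all-∧ off-x (freeFrom H S) T)) ⟩
    (independent H (x ∷ S) ∧ noEdges H (x ∷ S) T) ∧ independent H T ∎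
    where
    off-x : V → Bool
    off-x y = not (adjacent H x y)

  independent-cong : ∀ {H′ : Graph} {P : V → Set} {S} → All P S →
    (∀ {u v} → P u → P v → adjacent H u v ≡ adjacent H′ u v) → independent H S ≡ independent H′ S
  independent-cong []         agree = refl
  independent-cong (px ∷ pxs) agree = cong₂ _∧_ (all-cong (All.map (cong not ∘ agree px) pxs)) (independent-cong pxs agree)

  adjacent⇒¬independent : ∀ {x y} zs → adjacent H x y ≡ true → independent H (x ∷ y ∷ zs) ≢ true
  adjacent⇒¬independent zs xy rewrite xy = λ ()

  independent-++ʳ : ∀ S T → independent H (S ++ T) ≡ true → independent H T ≡ true
  independent-++ʳ S T = ∧-trueʳ _ ∘ trans (sym (independent-++ S T))

-- Adding two layers

extensions : Graph → List V → List V → (ℕ → ℕ) → ℕ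
extensions H U L′ h = Σ[ W ⊆ L′ ] (⟦ independent H W ∧ noEdges H U W ⟧ * h (length W))

-- With h weighing a set by its size, this says that the independent W ⊆ L′ with no edge to U
-- have size polynomial 1 + 2x, plus x + x² when U is empty.
Transfer : Graph → List V → List V → Set
Transfer H L L′ = ∀ {U} → U ⊆ L → independent H U ≡ true → ∀ h →
  extensions H U L′ h ≡ h 0 + 2 * h 1 + ⟦ length U ≡ᵇ 0 ⟧ * (h 1 + h 2)

module _ {H : Graph} {vs L L′ : List V}
         (separated : All (λ y → All (λ x → adjacent H x y ≡ false) vs) L′)
         (transfers : Transfer H L L′) where

  private
    w : ℕ → List V → ℕ
    w k S = ⟦ length S ≡ᵇ k ⟧ * ⟦ independent H S ⟧

  weight-split : ∀ {S W} → S ⊆ vs → W ⊆ L′ → ∀ U k →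
    w k ((S ++ U) ++ W) ≡ ⟦ independent H (S ++ U) ⟧ * (⟦ independent H W ∧ noEdges H U W ⟧ * ⟦ length W + length (S ++ U) ≡ᵇ k ⟧)
  weight-split {S} {W} S⊆vs W⊆L′ U k = begin
    ⟦ length ((S ++ U) ++ W) ≡ᵇ k ⟧ * ⟦ independent H ((S ++ U) ++ W) ⟧
      ≡⟨ cong₂ (λ n p → ⟦ n ≡ᵇ k ⟧ * ⟦ p ⟧) (trans (length-++ (S ++ U)) (+-comm (length (S ++ U)) _)) (independent-++ H (S ++ U) W) ⟩
    ⟦ size ⟧ * ⟦ (i ∧ noEdges H (S ++ U) W) ∧ j ⟧
      ≡⟨ cong (λ p → ⟦ size ⟧ * ⟦ (i ∧ p) ∧ j ⟧) (trans (noEdges-++ˡ H S U W) (cong (_∧ e) S-W)) ⟩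
    ⟦ size ⟧ * ⟦ (i ∧ e) ∧ j ⟧
      ≡⟨ cong (λ p → ⟦ size ⟧ * ⟦ p ⟧) (trans (∧-assoc i e j) (cong (i ∧_) (∧-comm e j))) ⟩
    ⟦ size ⟧ * ⟦ i ∧ (j ∧ e) ⟧
      ≡⟨ cong (⟦ size ⟧ *_) (⟦∧⟧ i _) ⟩
    ⟦ size ⟧ * (⟦ i ⟧ * ⟦ j ∧ e ⟧)
      ≡⟨ trans (*-comm ⟦ size ⟧ _) (*-assoc ⟦ i ⟧ _ _) ⟩
    ⟦ i ⟧ * (⟦ j ∧ e ⟧ * ⟦ size ⟧) ∎
    where
    size i j e : Bool
    size = length W + length (S ++ U) ≡ᵇ k
    i = independent H (S ++ U)
    j = independent H W
    e = noEdges H U W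
    S-W : noEdges H S W ≡ true
    S-W = noEdges-true H (All-resp-⊆ W⊆L′ (All.map (All-resp-⊆ S⊆vs) separated))

  extend-to-L′ : ∀ {S U} → S ⊆ vs → U ⊆ L → ∀ k →
    Σ[ W ⊆ L′ ] w (2 + k) ((S ++ U) ++ W) ≡
      w (2 + k) (S ++ U) + 2 * w (1 + k) (S ++ U) + ⟦ length U ≡ᵇ 0 ⟧ * (w (1 + k) (S ++ U) + w k (S ++ U))
  extend-to-L′ {S} {U} S⊆vs U⊆L k = begin
    Σ[ W ⊆ L′ ] w (2 + k) ((S ++ U) ++ W)
      ≡⟨ ΣSub-cong L′ (λ W⊆L′ → weight-split S⊆vs W⊆L′ U (2 + k)) ⟩
    Σ[ W ⊆ L′ ] (⟦ i ⟧ * (⟦ independent H W ∧ noEdges H U W ⟧ * h (length W)))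
      ≡⟨ ΣSub-*ˡ L′ ⟦ i ⟧ _ ⟩
    ⟦ i ⟧ * extensions H U L′ h
      ≡⟨ ⟦⟧*-cong i (λ i≡true → transfers U⊆L (independent-++ʳ H S U i≡true) h) ⟩
    ⟦ i ⟧ * (h 0 + 2 * h 1 + ⟦ length U ≡ᵇ 0 ⟧ * (h 1 + h 2))
      ≡⟨ distribute ⟦ i ⟧ (h 0) (h 1) (h 2) ⟦ length U ≡ᵇ 0 ⟧ ⟩
    w (2 + k) (S ++ U) + 2 * w (1 + k) (S ++ U) + ⟦ length U ≡ᵇ 0 ⟧ * (w (1 + k) (S ++ U) + w k (S ++ U)) ∎
    where
    i : Bool
    i = independent H (S ++ U)
    -- h 1 and h 2 compute to the size tests for 1 + k and k, so h r * ⟦ i ⟧ is a weight w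
    h : ℕ → ℕ
    h r = ⟦ r + length (S ++ U) ≡ᵇ 2 + k ⟧
    distribute : ∀ p x y z q → p * (x + 2 * y + q * (y + z)) ≡ x * p + 2 * (y * p) + q * (y * p + z * p)
    distribute = solve-∀

  extend-to-L : ∀ {S} → S ⊆ vs → ∀ k →
    Σ[ U ⊆ L ] Σ[ W ⊆ L′ ] w (2 + k) ((S ++ U) ++ W) ≡
      Σ[ U ⊆ L ] w (2 + k) (S ++ U) + 2 * Σ[ U ⊆ L ] w (1 + k) (S ++ U) + (w (1 + k) S + w k S)
  extend-to-L {S} S⊆vs k = begin
    Σ[ U ⊆ L ] Σ[ W ⊆ L′ ] w (2 + k) ((S ++ U) ++ W)
      ≡⟨ ΣSub-cong L (λ U⊆L → extend-to-L′ S⊆vs U⊆L k) ⟩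
    Σ[ U ⊆ L ] (w (2 + k) (S ++ U) + 2 * w (1 + k) (S ++ U) + ⟦ length U ≡ᵇ 0 ⟧ * (w (1 + k) (S ++ U) + w k (S ++ U)))
      ≡⟨ ΣSub-linear L _ _ _ ⟩
    Σ[ U ⊆ L ] w (2 + k) (S ++ U) + 2 * Σ[ U ⊆ L ] w (1 + k) (S ++ U) + Σ[ U ⊆ L ] (⟦ length U ≡ᵇ 0 ⟧ * (w (1 + k) (S ++ U) + w k (S ++ U)))
      ≡⟨ cong (Σ[ U ⊆ L ] w (2 + k) (S ++ U) + 2 * Σ[ U ⊆ L ] w (1 + k) (S ++ U) +_)
              (trans (ΣSub-empty L _) (cong (λ T → w (1 + k) T + w k T) (++-identityʳ S))) ⟩
    Σ[ U ⊆ L ] w (2 + k) (S ++ U) + 2 * Σ[ U ⊆ L ] w (1 + k) (S ++ U) + (w (1 + k) S + w k S) ∎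

  numIndepIn-layers : ∀ k →
    numIndepIn H ((vs ++ L) ++ L′) (2 + k) ≡
      numIndepIn H (vs ++ L) (2 + k) + 2 * numIndepIn H (vs ++ L) (1 + k) + numIndepIn H vs (1 + k) + numIndepIn H vs k
  numIndepIn-layers k = begin
    numIndepIn H ((vs ++ L) ++ L′) (2 + k)
      ≡⟨ trans (ΣSub-++ (vs ++ L) L′ _) (ΣSub-++ vs L _) ⟩
    Σ[ S ⊆ vs ] Σ[ U ⊆ L ] Σ[ W ⊆ L′ ] w (2 + k) ((S ++ U) ++ W)
      ≡⟨ ΣSub-cong vs (λ S⊆vs → extend-to-L S⊆vs k) ⟩
    Σ[ S ⊆ vs ] (Σ[ U ⊆ L ] w (2 + k) (S ++ U) + 2 * Σ[ U ⊆ L ] w (1 + k) (S ++ U) + (w (1 + k) S + w k S))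
      ≡⟨ ΣSub-linear vs _ _ _ ⟩
    Σ[ S ⊆ vs ] Σ[ U ⊆ L ] w (2 + k) (S ++ U) + 2 * Σ[ S ⊆ vs ] Σ[ U ⊆ L ] w (1 + k) (S ++ U) + Σ[ S ⊆ vs ] (w (1 + k) S + w k S)
      ≡⟨ cong₂ (λ p q → p + 2 * q + Σ[ S ⊆ vs ] (w (1 + k) S + w k S)) (ΣSub-++ vs L (w (2 + k))) (ΣSub-++ vs L (w (1 + k))) ⟨
    N₂ + 2 * N₁ + Σ[ S ⊆ vs ] (w (1 + k) S + w k S)
      ≡⟨ cong (N₂ + 2 * N₁ +_) (ΣSub-+ vs (w (1 + k)) (w k)) ⟩
    N₂ + 2 * N₁ + (numIndepIn H vs (1 + k) + numIndepIn H vs k)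
      ≡⟨ +-assoc (N₂ + 2 * N₁) _ _ ⟨
    N₂ + 2 * N₁ + numIndepIn H vs (1 + k) + numIndepIn H vs k ∎
    where
    N₂ N₁ : ℕ
    N₂ = numIndepIn H (vs ++ L) (2 + k)
    N₁ = numIndepIn H (vs ++ L) (1 + k)

extensions-path : ∀ H {y₁ y₂ y₃} → adjacent H y₁ y₂ ≡ true → adjacent H y₂ y₃ ≡ true → adjacent H y₁ y₃ ≡ false →
  ∀ U h → extensions H U (y₁ ∷ y₂ ∷ y₃ ∷ []) h ≡
    h 0 + (⟦ freeFrom H U y₂ ⟧ + (⟦ freeFrom H U y₁ ⟧ + ⟦ freeFrom H U y₃ ⟧)) * h 1 + ⟦ freeFrom H U y₁ ∧ freeFrom H U y₃ ⟧ * h 2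
extensions-path H {y₁} {y₂} {y₃} y₁y₂ y₂y₃ y₁y₃ U h
  rewrite y₁y₂ | y₂y₃ | y₁y₃
        | ∧-identityʳ (freeFrom H U y₁) | ∧-identityʳ (freeFrom H U y₂) | ∧-identityʳ (freeFrom H U y₃) =
  count (h 0) (h 1) (h 2) ⟦ freeFrom H U y₁ ⟧ ⟦ freeFrom H U y₂ ⟧ ⟦ freeFrom H U y₃ ⟧ ⟦ freeFrom H U y₁ ∧ freeFrom H U y₃ ⟧
  where
  -- the terms for W = [], y₃, y₂, y₂y₃, y₁, y₁y₃, y₁y₂, y₁y₂y₃, in the order ΣSub lists them
  count : ∀ h₀ h₁ h₂ p₁ p₂ p₃ p₁₃ →
    (1 * h₀ + p₃ * h₁) + (p₂ * h₁ + 0) + ((p₁ * h₁ + p₁₃ * h₂) + (0 + 0)) ≡ h₀ + (p₂ + (p₁ + p₃)) * h₁ + p₁₃ * h₂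
  count = solve-∀

record ConsecutiveLayers (H : Graph) (x₁ x₂ x₃ y₁ y₂ y₃ : V) : Set where
  field
    x₁x₂ : adjacent H x₁ x₂ ≡ true
    x₂x₃ : adjacent H x₂ x₃ ≡ true
    y₁y₂ : adjacent H y₁ y₂ ≡ true
    y₂y₃ : adjacent H y₂ y₃ ≡ true
    y₁y₃ : adjacent H y₁ y₃ ≡ false
    x₁y₁ : adjacent H x₁ y₁ ≡ true
    x₂y₁ : adjacent H x₂ y₁ ≡ false
    x₃y₁ : adjacent H x₃ y₁ ≡ true
    x₁y₂ : adjacent H x₁ y₂ ≡ false
    x₂y₂ : adjacent H x₂ y₂ ≡ false
    x₃y₂ : adjacent H x₃ y₂ ≡ false
    x₁y₃ : adjacent H x₁ y₃ ≡ false
    x₂y₃ : adjacent H x₂ y₃ ≡ true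
    x₃y₃ : adjacent H x₃ y₃ ≡ false

module _ {H x₁ x₂ x₃ y₁ y₂ y₃} (layers : ConsecutiveLayers H x₁ x₂ x₃ y₁ y₂ y₃) where
  open ConsecutiveLayers layers

  blocks-exactly-one : ∀ {U} → U ⊆ (x₁ ∷ x₂ ∷ x₃ ∷ []) → independent H U ≡ true →
      ⟦ freeFrom H U y₁ ⟧ + ⟦ freeFrom H U y₃ ⟧ ≡ 1 + ⟦ length U ≡ᵇ 0 ⟧
    × freeFrom H U y₁ ∧ freeFrom H U y₃ ≡ (length U ≡ᵇ 0)
  blocks-exactly-one (_ ∷ʳ _ ∷ʳ _ ∷ʳ [])       _ = refl , refl
  blocks-exactly-one (refl ∷ _ ∷ʳ _ ∷ʳ [])     _ rewrite x₁y₁ | x₁y₃ = refl , refl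
  blocks-exactly-one (_ ∷ʳ refl ∷ _ ∷ʳ [])     _ rewrite x₂y₁ | x₂y₃ = refl , refl
  blocks-exactly-one (_ ∷ʳ _ ∷ʳ refl ∷ [])     _ rewrite x₃y₁ | x₃y₃ = refl , refl
  blocks-exactly-one (refl ∷ _ ∷ʳ refl ∷ [])   _ rewrite x₁y₁ | x₁y₃ | x₃y₃ = refl , refl
  blocks-exactly-one (refl ∷ refl ∷ _ ∷ʳ [])   indep = ⊥-elim (adjacent⇒¬independent H [] x₁x₂ indep)
  blocks-exactly-one (_ ∷ʳ refl ∷ refl ∷ [])   indep = ⊥-elim (adjacent⇒¬independent H [] x₂x₃ indep)
  blocks-exactly-one (refl ∷ refl ∷ refl ∷ []) indep = ⊥-elim (adjacent⇒¬independent H (x₃ ∷ []) x₁x₂ indep)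

  transfer : Transfer H (x₁ ∷ x₂ ∷ x₃ ∷ []) (y₁ ∷ y₂ ∷ y₃ ∷ [])
  transfer {U} U⊆L indep h = begin
    extensions H U (y₁ ∷ y₂ ∷ y₃ ∷ []) h
      ≡⟨ extensions-path H y₁y₂ y₂y₃ y₁y₃ U h ⟩
    h 0 + (⟦ freeFrom H U y₂ ⟧ + (⟦ freeFrom H U y₁ ⟧ + ⟦ freeFrom H U y₃ ⟧)) * h 1 + ⟦ freeFrom H U y₁ ∧ freeFrom H U y₃ ⟧ * h 2
      ≡⟨ cong₂ (λ p q → h 0 + p * h 1 + ⟦ q ⟧ * h 2)
              (cong₂ _+_ (cong ⟦_⟧ y₂-free) (proj₁ (blocks-exactly-one U⊆L indep))) (proj₂ (blocks-exactly-one U⊆L indep)) ⟩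
    h 0 + (1 + (1 + ⟦ length U ≡ᵇ 0 ⟧)) * h 1 + ⟦ length U ≡ᵇ 0 ⟧ * h 2
      ≡⟨ regroup (h 0) (h 1) (h 2) ⟦ length U ≡ᵇ 0 ⟧ ⟩
    h 0 + 2 * h 1 + ⟦ length U ≡ᵇ 0 ⟧ * (h 1 + h 2) ∎
    where
    y₂-free : freeFrom H U y₂ ≡ true
    y₂-free = freeFrom-true H (All-resp-⊆ U⊆L (x₁y₂ ∷ x₂y₂ ∷ x₃y₂ ∷ []))
    regroup : ∀ h₀ h₁ h₂ z → h₀ + (1 + (1 + z)) * h₁ + z * h₂ ≡ h₀ + 2 * h₁ + z * (h₁ + h₂)
    regroup = solve-∀

-- The graphs G m

idx : V → ℕ
idx (a i) = i
idx (b i) = i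
idx (c i) = i

layer : ℕ → List V
layer j = a j ∷ b j ∷ c j ∷ []

stepEdges : ℕ → List (V × V)
stepEdges m = (a m , a (suc m)) ∷ (b m , c (suc m)) ∷ (a (suc m) , b (suc m)) ∷ (b (suc m) , c (suc m)) ∷ extra m

joins : V → V → V × V → Bool
joins u v (x , y) = ((x == u) ∧ (y == v)) ∨ ((x == v) ∧ (y == u))

adjacent-step : ∀ m H u v → adjacent (step m H) u v ≡ adjacent H u v ∨ any (joins u v) (stepEdges m)
adjacent-step m H u v = any-++ (joins u v) (edges H) (stepEdges m)

≡ᵇ-refl : ∀ n → (n ≡ᵇ n) ≡ true
≡ᵇ-refl zero    = refl
≡ᵇ-refl (suc n) = ≡ᵇ-refl n

≢⇒≡ᵇ-false : ∀ {m n} → m ≢ n → (m ≡ᵇ n) ≡ false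
≢⇒≡ᵇ-false {m} {n} m≢n = ¬-not (λ eq → m≢n (≡ᵇ⇒≡ m n (subst T (sym eq) _)))

==-idx : ∀ u v → idx u ≢ idx v → (u == v) ≡ false
==-idx (a i) (a j) i≢j = ≢⇒≡ᵇ-false i≢j
==-idx (b i) (b j) i≢j = ≢⇒≡ᵇ-false i≢j
==-idx (c i) (c j) i≢j = ≢⇒≡ᵇ-false i≢j
==-idx (a _) (b _) _   = refl
==-idx (a _) (c _) _   = refl
==-idx (b _) (a _) _   = refl
==-idx (b _) (c _) _   = refl
==-idx (c _) (a _) _   = refl
==-idx (c _) (b _) _   = refl

joins-sym : ∀ u v e → joins u v e ≡ joins v u e
joins-sym u v (x , y) = ∨-comm ((x == u) ∧ (y == v)) _

joins-≢ʳ : ∀ {u v} e → idx (proj₁ e) ≢ idx v → idx (proj₂ e) ≢ idx v → joins u v e ≡ false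
joins-≢ʳ {u} {v} (x , y) x≢v y≢v rewrite ==-idx x v x≢v | ==-idx y v y≢v | ∧-zeroʳ (x == u) = refl

joins-≢ˡ : ∀ {u v} e → idx (proj₁ e) ≢ idx u → idx (proj₂ e) ≢ idx u → joins u v e ≡ false
joins-≢ˡ {u} {v} e x≢u y≢u = trans (joins-sym u v e) (joins-≢ʳ e x≢u y≢u)

joins-≢₂ : ∀ {u v} e → idx (proj₂ e) ≢ idx u → idx (proj₂ e) ≢ idx v → joins u v e ≡ false
joins-≢₂ {u} {v} (x , y) y≢u y≢v
  rewrite ==-idx y u y≢u | ==-idx y v y≢v | ∧-zeroʳ (x == u) | ∧-zeroʳ (x == v) = refl

StepEdge : ℕ → V × V → Set
StepEdge m (x , y) = m ≤ idx x × idx x ≤ suc m × idx y ≡ suc m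

stepEdges-layers : ∀ m → All (StepEdge m) (stepEdges m)
stepEdges-layers m = (≤-refl , n≤1+n m , refl) ∷ (≤-refl , n≤1+n m , refl)
                   ∷ (n≤1+n m , ≤-refl , refl) ∷ (n≤1+n m , ≤-refl , refl) ∷ extra-layers m
  where
  extra-layers : ∀ m → All (StepEdge m) (extra m)
  extra-layers zero          = []
  extra-layers (suc zero)    = []
  extra-layers (suc (suc k)) = (≤-refl , n≤1+n _ , refl) ∷ []

edges-within : ∀ n → All (λ e → idx (proj₁ e) ≤ suc n × idx (proj₂ e) ≤ suc n) (edges (G (suc n)))
edges-within zero    = (≤-refl , ≤-refl) ∷ []
edges-within (suc n) = ++⁺ (All.map (λ (p , q) → m≤n⇒m≤1+n p , m≤n⇒m≤1+n q) (edges-within n))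
                           (All.map (λ (_ , p , q) → p , ≤-reflexive q) (stepEdges-layers (suc n)))

verts-within : ∀ n → All (λ v → idx v ≤ suc n) (verts (G (suc n)))
verts-within zero    = ≤-refl ∷ ≤-refl ∷ []
verts-within (suc n) = ++⁺ (All.map m≤n⇒m≤1+n (verts-within n)) (≤-refl ∷ ≤-refl ∷ ≤-refl ∷ [])

adjacent-beyond : ∀ n {u v} → suc n < idx v → adjacent (G (suc n)) u v ≡ false
adjacent-beyond n {u} {v} n<v = any-false (joins u v) (All.map (λ {e} → miss e) (edges-within n))
  where
  miss : ∀ e → idx (proj₁ e) ≤ suc n × idx (proj₂ e) ≤ suc n → joins u v e ≡ false
  miss e (x≤ , y≤) = joins-≢ʳ e (<⇒≢ (≤-<-trans x≤ n<v)) (<⇒≢ (≤-<-trans y≤ n<v))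

adjacent-last-layer : ∀ n {u v} → idx v ≡ 2 + n → adjacent (G (2 + n)) u v ≡ any (joins u v) (stepEdges (1 + n))
adjacent-last-layer n {u} {v} v-top =
  trans (adjacent-step (1 + n) (G (1 + n)) u v)
        (cong (_∨ any (joins u v) (stepEdges (1 + n))) (adjacent-beyond n (≤-reflexive (sym v-top))))

adjacent-induced : ∀ n {u v} → idx u ≤ suc n → idx v ≤ suc n →
  adjacent (G (2 + n)) u v ≡ adjacent (G (1 + n)) u v
adjacent-induced n {u} {v} u≤ v≤ = begin
  adjacent (G (2 + n)) u v
    ≡⟨ adjacent-step (1 + n) (G (1 + n)) u v ⟩
  adjacent (G (1 + n)) u v ∨ any (joins u v) (stepEdges (1 + n))
    ≡⟨ cong (adjacent (G (1 + n)) u v ∨_) (any-false (joins u v) (All.map (λ {e} → miss e) (stepEdges-layers (1 + n)))) ⟩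
  adjacent (G (1 + n)) u v ∨ false
    ≡⟨ ∨-identityʳ _ ⟩
  adjacent (G (1 + n)) u v ∎
  where
  miss : ∀ e → StepEdge (1 + n) e → joins u v e ≡ false
  miss e (_ , _ , y-top) =
    joins-≢₂ e (>⇒≢ (subst (idx u <_) (sym y-top) (s≤s u≤))) (>⇒≢ (subst (idx v <_) (sym y-top) (s≤s v≤)))

adjacent-separated : ∀ n {u v} → idx u ≤ suc n → idx v ≡ 3 + n → adjacent (G (3 + n)) u v ≡ false
adjacent-separated n {u} {v} u≤ v-top =
  trans (adjacent-last-layer (1 + n) v-top) (any-false (joins u v) (All.map (λ {e} → miss e) (stepEdges-layers (2 + n))))
  where
  miss : ∀ e → StepEdge (2 + n) e → joins u v e ≡ false
  miss e (x-lo , _ , y-top) =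
    joins-≢ˡ e (>⇒≢ (≤-trans (s≤s u≤) x-lo)) (>⇒≢ (subst (idx u <_) (sym y-top) (≤-trans (s≤s u≤) (n≤1+n _))))

numIndepIn-induced : ∀ n {xs} → All (λ v → idx v ≤ suc n) xs → ∀ k →
  numIndepIn (G (2 + n)) xs k ≡ numIndepIn (G (1 + n)) xs k
numIndepIn-induced n xs-within k = ΣSub-cong _ λ {S} S⊆xs →
  cong (λ p → ⟦ length S ≡ᵇ k ⟧ * ⟦ p ⟧) (independent-cong (G (2 + n)) (All-resp-⊆ S⊆xs xs-within) (adjacent-induced n))

-- every comparison of layer indices below is one of n ≡ᵇ n, n ≡ᵇ 1 + n and 1 + n ≡ᵇ n
stepEdges-joins : ∀ n → let j = 2 + n ; j′ = 3 + n ; top = λ u v → any (joins u v) (stepEdges j) in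
    any (joins (a j) (b j)) (stepEdges (1 + n)) ≡ true × any (joins (b j) (c j)) (stepEdges (1 + n)) ≡ true
  × top (a j′) (b j′) ≡ true  × top (b j′) (c j′) ≡ true  × top (a j′) (c j′) ≡ false
  × top (a j) (a j′) ≡ true   × top (b j) (a j′) ≡ false  × top (c j) (a j′) ≡ true
  × top (a j) (b j′) ≡ false  × top (b j) (b j′) ≡ false  × top (c j) (b j′) ≡ false
  × top (a j) (c j′) ≡ false  × top (b j) (c j′) ≡ true   × top (c j) (c j′) ≡ false
stepEdges-joins n rewrite ≡ᵇ-refl n | ≢⇒≡ᵇ-false (1+n≢n ∘ sym {x = n}) | ≢⇒≡ᵇ-false (1+n≢n {n}) =
  refl , refl , refl , refl , refl , refl , refl , refl , refl , refl , refl , refl , refl , refl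

consecutiveLayers : ∀ n → ConsecutiveLayers (G (3 + n)) (a (2 + n)) (b (2 + n)) (c (2 + n)) (a (3 + n)) (b (3 + n)) (c (3 + n))
consecutiveLayers n =
  let (ab , bc , a′b′ , b′c′ , a′c′ , aa′ , ba′ , ca′ , ab′ , bb′ , cb′ , ac′ , bc′ , cc′) = stepEdges-joins n in
  record
    { x₁x₂ = lower refl ab ; x₂x₃ = lower refl bc
    ; y₁y₂ = top refl a′b′ ; y₂y₃ = top refl b′c′ ; y₁y₃ = top refl a′c′
    ; x₁y₁ = top refl aa′  ; x₂y₁ = top refl ba′  ; x₃y₁ = top refl ca′
    ; x₁y₂ = top refl ab′  ; x₂y₂ = top refl bb′  ; x₃y₂ = top refl cb′
    ; x₁y₃ = top refl ac′  ; x₂y₃ = top refl bc′  ; x₃y₃ = top refl cc′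
    }
  where
  top : ∀ {u v β} → idx v ≡ 3 + n → any (joins u v) (stepEdges (2 + n)) ≡ β → adjacent (G (3 + n)) u v ≡ β
  top v-top = trans (adjacent-last-layer (1 + n) v-top)
  lower : ∀ {u v} → idx v ≡ 2 + n → any (joins u v) (stepEdges (1 + n)) ≡ true → adjacent (G (3 + n)) u v ≡ true
  lower {u} {v} v-top uv = trans (adjacent-step (2 + n) (G (2 + n)) u v)
                                 (cong (_∨ any (joins u v) (stepEdges (2 + n))) (trans (adjacent-last-layer n v-top) uv))

-- Counting faces

numIndep-recurrence : ∀ n k →
  numIndep (G (3 + n)) (2 + k) ≡
    numIndep (G (2 + n)) (2 + k) + 2 * numIndep (G (2 + n)) (1 + k) + numIndep (G (1 + n)) (1 + k) + numIndep (G (1 + n)) k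
numIndep-recurrence n k = begin
  numIndep (G (3 + n)) (2 + k)
    ≡⟨ numIndep≡numIndepIn (G (3 + n)) (2 + k) ⟩
  numIndepIn (G (3 + n)) ((verts (G (1 + n)) ++ layer (2 + n)) ++ layer (3 + n)) (2 + k)
    ≡⟨ numIndepIn-layers separated (transfer (consecutiveLayers n)) k ⟩
  numIndepIn (G (3 + n)) (verts (G (2 + n))) (2 + k) + 2 * numIndepIn (G (3 + n)) (verts (G (2 + n))) (1 + k)
    + numIndepIn (G (3 + n)) (verts (G (1 + n))) (1 + k) + numIndepIn (G (3 + n)) (verts (G (1 + n))) k
    ≡⟨ cong₂ _+_ (cong₂ _+_ (cong₂ (λ p q → p + 2 * q) (restrict₂ (2 + k)) (restrict₂ (1 + k))) (restrict₁ (1 + k))) (restrict₁ k) ⟩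
  numIndep (G (2 + n)) (2 + k) + 2 * numIndep (G (2 + n)) (1 + k) + numIndep (G (1 + n)) (1 + k) + numIndep (G (1 + n)) k ∎
  where
  separated : All (λ y → All (λ x → adjacent (G (3 + n)) x y ≡ false) (verts (G (1 + n)))) (layer (3 + n))
  separated = apart refl ∷ apart refl ∷ apart refl ∷ []
    where
    apart : ∀ {y} → idx y ≡ 3 + n → All (λ x → adjacent (G (3 + n)) x y ≡ false) (verts (G (1 + n)))
    apart y-top = All.map (λ x≤ → adjacent-separated n x≤ y-top) (verts-within n)
  restrict₂ : ∀ k → numIndepIn (G (3 + n)) (verts (G (2 + n))) k ≡ numIndep (G (2 + n)) k
  restrict₂ k = trans (numIndepIn-induced (1 + n) (verts-within (1 + n)) k) (sym (numIndep≡numIndepIn (G (2 + n)) k))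
  restrict₁ : ∀ k → numIndepIn (G (3 + n)) (verts (G (1 + n))) k ≡ numIndep (G (1 + n)) k
  restrict₁ k = begin
    numIndepIn (G (3 + n)) (verts (G (1 + n))) k ≡⟨ numIndepIn-induced (1 + n) (All.map m≤n⇒m≤1+n (verts-within n)) k ⟩
    numIndepIn (G (2 + n)) (verts (G (1 + n))) k ≡⟨ numIndepIn-induced n (verts-within n) k ⟩
    numIndepIn (G (1 + n)) (verts (G (1 + n))) k ≡⟨ numIndep≡numIndepIn (G (1 + n)) k ⟨
    numIndep (G (1 + n)) k ∎

numIndep-vanishes : ∀ n k → suc n < k → numIndep (G (suc n)) k ≡ 0
numIndep-vanishes zero          (suc zero)                               (s≤s ())
numIndep-vanishes zero          (suc (suc zero))                         _ = refl
numIndep-vanishes zero          (suc (suc (suc k)))                      _ = refl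
numIndep-vanishes (suc zero)    (suc zero)                               (s≤s ())
numIndep-vanishes (suc zero)    (suc (suc zero))                         (s≤s (s≤s ()))
numIndep-vanishes (suc zero)    (suc (suc (suc zero)))                   _ = refl
numIndep-vanishes (suc zero)    (suc (suc (suc (suc zero))))             _ = refl
numIndep-vanishes (suc zero)    (suc (suc (suc (suc (suc zero)))))       _ = refl
numIndep-vanishes (suc zero)    (suc (suc (suc (suc (suc (suc k))))))    _ = refl
numIndep-vanishes (suc (suc n)) (suc (suc k)) (s≤s (s≤s n<k)) = begin
  numIndep (G (3 + n)) (2 + k)
    ≡⟨ numIndep-recurrence n k ⟩
  numIndep (G (2 + n)) (2 + k) + 2 * numIndep (G (2 + n)) (1 + k) + numIndep (G (1 + n)) (1 + k) + numIndep (G (1 + n)) k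
    ≡⟨ cong₂ _+_ (cong₂ _+_ (cong₂ (λ p q → p + 2 * q)
         (numIndep-vanishes (suc n) (2 + k) (s≤s (s≤s (<⇒≤ n<k)))) (numIndep-vanishes (suc n) (1 + k) (s≤s n<k)))
         (numIndep-vanishes n (1 + k) (s≤s (<⇒≤ n<k)))) (numIndep-vanishes n k n<k) ⟩
  0 ∎

length-verts : ∀ n → length (verts (G (suc n))) ≡ 2 + 3 * n
length-verts zero    = refl
length-verts (suc n) = trans (length-++ (verts (G (suc n)))) (trans (cong (_+ 3) (length-verts n)) (grow n))
  where
  grow : ∀ n → 2 + 3 * n + 3 ≡ 2 + 3 * suc n
  grow = solve-∀

numIndep-G-1 : ∀ n → numIndep (G (suc n)) 1 ≡ 2 + 3 * n
numIndep-G-1 n = trans (numIndep≡numIndepIn (G (suc n)) 1) (trans (numIndepIn-1 (G (suc n)) (verts (G (suc n)))) (length-verts n))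

numIndep-G-2 : ∀ n → 2 * numIndep (G (2 + n)) 2 + 19 * (2 + n) ≡ 9 * ((2 + n) * (2 + n)) + 12
numIndep-G-2 zero    = refl
numIndep-G-2 (suc n) = begin
  2 * numIndep (G (3 + n)) 2 + 19 * (3 + n)
    ≡⟨ cong (λ t → 2 * t + 19 * (3 + n)) (numIndep-recurrence n 0) ⟩
  2 * (N₂ + 2 * numIndep (G (2 + n)) 1 + numIndep (G (1 + n)) 1 + numIndep (G (1 + n)) 0) + 19 * (3 + n)
    ≡⟨ cong₂ (λ p q → 2 * (N₂ + 2 * p + q + numIndep (G (1 + n)) 0) + 19 * (3 + n)) (numIndep-G-1 (suc n)) (numIndep-G-1 n) ⟩
  2 * (N₂ + 2 * (2 + 3 * suc n) + (2 + 3 * n) + numIndep (G (1 + n)) 0) + 19 * (3 + n)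
    ≡⟨ cong (λ t → 2 * (N₂ + 2 * (2 + 3 * suc n) + (2 + 3 * n) + t) + 19 * (3 + n)) (numIndep-0 (G (1 + n))) ⟩
  2 * (N₂ + 2 * (2 + 3 * suc n) + (2 + 3 * n) + 1) + 19 * (3 + n)
    ≡⟨ split N₂ n ⟩
  2 * N₂ + 19 * (2 + n) + (18 * n + 45)
    ≡⟨ cong (_+ (18 * n + 45)) (numIndep-G-2 n) ⟩
  9 * ((2 + n) * (2 + n)) + 12 + (18 * n + 45)
    ≡⟨ square n ⟩
  9 * ((3 + n) * (3 + n)) + 12 ∎
  where
  N₂ : ℕ
  N₂ = numIndep (G (2 + n)) 2
  split : ∀ x n → 2 * (x + 2 * (2 + 3 * suc n) + (2 + 3 * n) + 1) + 19 * (3 + n) ≡ 2 * x + 19 * (2 + n) + (18 * n + 45)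
  split = solve-∀
  square : ∀ n → 9 * ((2 + n) * (2 + n)) + 12 + (18 * n + 45) ≡ 9 * ((3 + n) * (3 + n)) + 12
  square = solve-∀

f≡numIndep : ∀ n {i} → i ≤ suc n → f (suc n) i ≡ numIndep (G (suc n)) (suc i)
f≡numIndep n {i} i≤ with m≤n⇒m<n∨m≡n i≤
... | inj₁ i<n rewrite ≢⇒≡ᵇ-false (>⇒≢ i<n) = refl
... | inj₂ refl rewrite ≡ᵇ-refl n = sym (numIndep-vanishes n (2 + n) ≤-refl)

faces-0 : (m : ℕ) → 1 ≤ m → f m 0 ≡ 3 * m ∸ 1
faces-0 zero    ()
faces-0 (suc n) _ = begin
  f (suc n) 0            ≡⟨ f≡numIndep n z≤n ⟩
  numIndep (G (suc n)) 1 ≡⟨ numIndep-G-1 n ⟩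
  2 + 3 * n              ≡⟨ cong (_∸ 1) (*-suc 3 n) ⟨
  3 * suc n ∸ 1          ∎

faces-1 : (m : ℕ) → 2 ≤ m → 2 * f m 1 + 19 * m ≡ 9 * (m * m) + 12
faces-1 (suc zero)    (s≤s ())
faces-1 (suc (suc n)) _ = trans (cong (λ t → 2 * t + 19 * (2 + n)) (f≡numIndep (suc n) (s≤s z≤n))) (numIndep-G-2 n)

faces-recurrence : (m i : ℕ) → 3 ≤ m → 2 ≤ i → i ≤ m ∸ 1 →
  f m i ≡ 2 * f (m ∸ 1) (i ∸ 1) + f (m ∸ 1) i + f (m ∸ 2) (i ∸ 2) + f (m ∸ 2) (i ∸ 1)
faces-recurrence _ (suc zero) _ (s≤s ()) _
faces-recurrence (suc (suc (suc n))) (suc (suc j)) _ _ (s≤s (s≤s j≤n)) = begin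
  f (3 + n) (2 + j)
    ≡⟨ f≡numIndep (2 + n) (s≤s (s≤s (m≤n⇒m≤1+n j≤n))) ⟩
  numIndep (G (3 + n)) (3 + j)
    ≡⟨ numIndep-recurrence n (1 + j) ⟩
  numIndep (G (2 + n)) (3 + j) + 2 * numIndep (G (2 + n)) (2 + j) + numIndep (G (1 + n)) (2 + j) + numIndep (G (1 + n)) (1 + j)
    ≡⟨ reorder (numIndep (G (2 + n)) (3 + j)) (numIndep (G (2 + n)) (2 + j)) (numIndep (G (1 + n)) (2 + j)) (numIndep (G (1 + n)) (1 + j)) ⟩
  2 * numIndep (G (2 + n)) (2 + j) + numIndep (G (2 + n)) (3 + j) + numIndep (G (1 + n)) (1 + j) + numIndep (G (1 + n)) (2 + j)
    ≡⟨ cong₂ _+_ (cong₂ _+_ (cong₂ (λ p q → 2 * p + q)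
         (f≡numIndep (1 + n) (s≤s (m≤n⇒m≤1+n j≤n))) (f≡numIndep (1 + n) (s≤s (s≤s j≤n))))
         (f≡numIndep n (m≤n⇒m≤1+n j≤n))) (f≡numIndep n (s≤s j≤n)) ⟨
  2 * f (2 + n) (1 + j) + f (2 + n) (2 + j) + f (1 + n) j + f (1 + n) (1 + j) ∎
  where
  reorder : ∀ w x y z → w + 2 * x + y + z ≡ 2 * x + w + z + y
  reorder = solve-∀

proposition5p1 :
    ((m : ℕ) → 1 ≤ m → f m 0 ≡ 3 * m ∸ 1)
    × ((m : ℕ) → 2 ≤ m → 2 * f m 1 + 19 * m ≡ 9 * (m * m) + 12)
    × ((m i : ℕ) → 3 ≤ m → 2 ≤ i → i ≤ m ∸ 1 →
        f m i ≡ 2 * f (m ∸ 1) (i ∸ 1) + f (m ∸ 1) i + f (m ∸ 2) (i ∸ 2) + f (m ∸ 2) (i ∸ 1))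
proposition5p1 = faces-0 , faces-1 , faces-recurrence
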